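{- The underlying multigraph functor $U:\mathfrak{Q}\to\mathfrak{M}$ is not continuous, and the associated digraph functor $\overrightarrow{D}:\mathfrak{M}\to\mathfrak{Q}$ is not cocontinuous.
   Context: A quiver $Q$ consists of sets $\overrightarrow{V}(Q)$, $\overrightarrow{E}(Q)$ and functions $\sigma_Q,\tau_Q:\overrightarrow{E}(Q)\to\overrightarrow{V}(Q)$; morphisms are pairs of functions on vertices and edges commuting with $\sigma$ and $\tau$ (category $\mathfrak{Q}$). A set-system hypergraph $G$ consists of sets $V(G)$, $E(G)$ and $\epsilon_G:E(G)\to\mathcal{P}(V(G))$; morphisms are pairs $(E(\phi),V(\phi))$ with $\epsilon_H\circ E(\phi)=\mathcal{P}V(\phi)\circ\epsilon_G$ ($\mathcal{P}f(A)$ the image). A multigraph is a set-system hypergraph with $1\le|\epsilon_G(e)|\le2$ for all $e$; $\mathfrak{M}$ is the full subcategory of multigraphs. $U$ sends $Q$ to the multigraph with vertex set $\overrightarrow{V}(Q)$, edge set $\overrightarrow{E}(Q)$, $\epsilon_{U(Q)}(e)=\{\sigma_Q(e),\tau_Q(e)\}$, and is the identity on underlying functions of morphisms. $\overrightarrow{D}(G)$ is the quiver with vertex set $V(G)$, edges $\{(e,v,w):\epsilon_G(e)=\{v,w\},v\ne w\}\cup\{(e,v,v):\epsilon_G(e)=\{v\}\}$, source $(e,v,w)\mapsto v$, target $(e,v,w)\mapsto w$; on a morphism $\phi$ it acts by $V(\phi)$ on vertices and $(e,v,w)\mapsto(E(\phi)(e),V(\phi)(v),V(\phi)(w))$ on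 edges ($\overrightarrow{D}$ is right adjoint to $U$). -}

module Defs where

open import Level using (Level; _⊔_; 0ℓ) renaming (suc to lsuc)
open import Data.Product using (Σ; ∃; _×_; _,_; proj₁; proj₂)
open import Data.Sum using (_⊎_; inj₁; inj₂)
open import Function.Bundles using (_⇔_; mk⇔; Equivalence)
open import Relation.Binary.PropositionalEquality
  using (_≡_; refl; sym; trans; cong)
open import Relation.Binary.Structures using (IsEquivalence)

record Category (o h e : Level) : Set (lsuc (o ⊔ h ⊔ e)) where
  infixr 9 _∘_
  infix 4 _≈_
  field
    Obj : Set o
    _⇒_ : Obj → Obj → Set h
    _≈_ : ∀ {A B} → A ⇒ B → A ⇒ B → Set e
    id  : ∀ {A} → A ⇒ A
    _∘_ : ∀ {A B C} → B ⇒ C → A ⇒ B → A ⇒ C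
    ≈-equiv : ∀ {A B} → IsEquivalence (_≈_ {A} {B})
    assoc : ∀ {A B C D} (f : A ⇒ B) (g : B ⇒ C) (k : C ⇒ D) →
            (k ∘ g) ∘ f ≈ k ∘ (g ∘ f)
    identityˡ : ∀ {A B} (f : A ⇒ B) → id ∘ f ≈ f
    identityʳ : ∀ {A B} (f : A ⇒ B) → f ∘ id ≈ f
    ∘-resp-≈ : ∀ {A B C} {f f′ : B ⇒ C} {g g′ : A ⇒ B} →
               f ≈ f′ → g ≈ g′ → f ∘ g ≈ f′ ∘ g′

record Functor {o h e o′ h′ e′ : Level}
               (C : Category o h e) (D : Category o′ h′ e′)
               : Set (o ⊔ h ⊔ e ⊔ o′ ⊔ h′ ⊔ e′) where
  private
    module C = Category C
    module D = Category D
  field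
    F₀ : C.Obj → D.Obj
    F₁ : ∀ {A B} → A C.⇒ B → F₀ A D.⇒ F₀ B
    identity : ∀ {A} → F₁ (C.id {A}) D.≈ D.id
    homomorphism : ∀ {A B C} (f : A C.⇒ B) (g : B C.⇒ C) →
                   F₁ (g C.∘ f) D.≈ F₁ g D.∘ F₁ f
    F-resp-≈ : ∀ {A B} {f g : A C.⇒ B} → f C.≈ g → F₁ f D.≈ F₁ g

SmallCategory : Set₁
SmallCategory = Category 0ℓ 0ℓ 0ℓ

module _ {o h e : Level} {J : SmallCategory} {C : Category o h e}
         (F : Functor J C) where
  private
    module J = Category J
    module C = Category C
    module F = Functor F

  record Cone : Set (o ⊔ h ⊔ e) where
    field
      apex : C.Obj
      leg  : ∀ X → apex C.⇒ F.F₀ X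
      commute : ∀ {X Y} (f : X J.⇒ Y) → F.F₁ f C.∘ leg X C.≈ leg Y

  record Cocone : Set (o ⊔ h ⊔ e) where
    field
      coapex : C.Obj
      coleg  : ∀ X → F.F₀ X C.⇒ coapex
      cocommute : ∀ {X Y} (f : X J.⇒ Y) → coleg Y C.∘ F.F₁ f C.≈ coleg X

  IsLimit : Cone → Set (o ⊔ h ⊔ e)
  IsLimit c = ∀ (c′ : Cone) →
    Σ (Cone.apex c′ C.⇒ Cone.apex c) λ u →
      (∀ X → Cone.leg c X C.∘ u C.≈ Cone.leg c′ X) ×
      (∀ (u′ : Cone.apex c′ C.⇒ Cone.apex c) →
         (∀ X → Cone.leg c X C.∘ u′ C.≈ Cone.leg c′ X) → u′ C.≈ u)

  IsColimit : Cocone → Set (o ⊔ h ⊔ e)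
  IsColimit c = ∀ (c′ : Cocone) →
    Σ (Cocone.coapex c C.⇒ Cocone.coapex c′) λ u →
      (∀ X → u C.∘ Cocone.coleg c X C.≈ Cocone.coleg c′ X) ×
      (∀ (u′ : Cocone.coapex c C.⇒ Cocone.coapex c′) →
         (∀ X → u′ C.∘ Cocone.coleg c X C.≈ Cocone.coleg c′ X) → u′ C.≈ u)

_∘F_ : ∀ {o₁ h₁ e₁ o₂ h₂ e₂ o₃ h₃ e₃}
         {A : Category o₁ h₁ e₁} {B : Category o₂ h₂ e₂} {C : Category o₃ h₃ e₃} →
       Functor B C → Functor A B → Functor A C
_∘F_ {B = B} {C = C} G F = record
  { F₀ = λ X → G.F₀ (F.F₀ X)
  ; F₁ = λ f → G.F₁ (F.F₁ f)
  ; identity = C.Equiv.trans (G.F-resp-≈ F.identity) G.identity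
  ; homomorphism = λ f g → C.Equiv.trans (G.F-resp-≈ (F.homomorphism f g))
                                          (G.homomorphism (F.F₁ f) (F.F₁ g))
  ; F-resp-≈ = λ p → G.F-resp-≈ (F.F-resp-≈ p)
  }
  where
    module G = Functor G
    module F = Functor F
    module C where
      open Category C public
      module Equiv {X Y} = IsEquivalence (≈-equiv {X} {Y})

module _ {o h e o′ h′ e′ : Level} {J : SmallCategory}
         {C : Category o h e} {D : Category o′ h′ e′}
         (G : Functor C D) {F : Functor J C} where
  private
    module C = Category C
    module D = Category D
    module G = Functor G
    module F = Functor F
    module DE {A B} = IsEquivalence (D.≈-equiv {A} {B})

  mapCone : Cone F → Cone (G ∘F F)
  mapCone c = record
    { apex = G.F₀ (Cone.apex c)
    ; leg = λ X → G.F₁ (Cone.leg c X)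
    ; commute = λ f → DE.trans (DE.sym (G.homomorphism (Cone.leg c _) (F.F₁ f)))
                               (G.F-resp-≈ (Cone.commute c f))
    }

  mapCocone : Cocone F → Cocone (G ∘F F)
  mapCocone c = record
    { coapex = G.F₀ (Cocone.coapex c)
    ; coleg = λ X → G.F₁ (Cocone.coleg c X)
    ; cocommute = λ f → DE.trans (DE.sym (G.homomorphism (F.F₁ f) (Cocone.coleg c _)))
                                 (G.F-resp-≈ (Cocone.cocommute c f))
    }

Continuous : ∀ {o h e o′ h′ e′} {C : Category o h e} {D : Category o′ h′ e′} →
             Functor C D → Set (lsuc 0ℓ ⊔ o ⊔ h ⊔ e ⊔ o′ ⊔ h′ ⊔ e′)
Continuous {C = C} G =
  ∀ {J : SmallCategory} (F : Functor J C) (c : Cone F) →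
    IsLimit F c → IsLimit (G ∘F F) (mapCone G c)

Cocontinuous : ∀ {o h e o′ h′ e′} {C : Category o h e} {D : Category o′ h′ e′} →
               Functor C D → Set (lsuc 0ℓ ⊔ o ⊔ h ⊔ e ⊔ o′ ⊔ h′ ⊔ e′)
Cocontinuous {C = C} G =
  ∀ {J : SmallCategory} (F : Functor J C) (c : Cocone F) →
    IsColimit F c → IsColimit (G ∘F F) (mapCocone G c)

record Quiver : Set₁ where
  field
    V E : Set
    σ τ : E → V

record QuiverHom (Q R : Quiver) : Set where
  private
    module Q = Quiver Q
    module R = Quiver R
  field
    fV : Q.V → R.V
    fE : Q.E → R.E
    σ-comm : ∀ e → R.σ (fE e) ≡ fV (Q.σ e)
    τ-comm : ∀ e → R.τ (fE e) ≡ fV (Q.τ e)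
open QuiverHom

_≈Q_ : ∀ {Q R} → QuiverHom Q R → QuiverHom Q R → Set
f ≈Q g = (∀ v → fV f v ≡ fV g v) × (∀ e → fE f e ≡ fE g e)

idQ : ∀ {Q} → QuiverHom Q Q
idQ = record { fV = λ v → v ; fE = λ e → e ; σ-comm = λ _ → refl ; τ-comm = λ _ → refl }

_∘Q_ : ∀ {P Q R} → QuiverHom Q R → QuiverHom P Q → QuiverHom P R
g ∘Q f = record
  { fV = λ v → fV g (fV f v)
  ; fE = λ e → fE g (fE f e)
  ; σ-comm = λ e → trans (σ-comm g (fE f e)) (cong (fV g) (σ-comm f e))
  ; τ-comm = λ e → trans (τ-comm g (fE f e)) (cong (fV g) (τ-comm f e))
  }

QuiverCat : Category (lsuc 0ℓ) 0ℓ 0ℓ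
QuiverCat = record
  { Obj = Quiver
  ; _⇒_ = QuiverHom
  ; _≈_ = _≈Q_
  ; id = idQ
  ; _∘_ = _∘Q_
  ; ≈-equiv = record
      { refl = (λ _ → refl) , (λ _ → refl)
      ; sym = λ p → (λ v → sym (proj₁ p v)) , (λ e → sym (proj₂ p e))
      ; trans = λ p q → (λ v → trans (proj₁ p v) (proj₁ q v))
                      , (λ e → trans (proj₂ p e) (proj₂ q e))
      }
  ; assoc = λ _ _ _ → (λ _ → refl) , (λ _ → refl)
  ; identityˡ = λ _ → (λ _ → refl) , (λ _ → refl)
  ; identityʳ = λ _ → (λ _ → refl) , (λ _ → refl)
  ; ∘-resp-≈ = λ {_} {_} {_} {f} {f′} {g} {g′} p q →
      (λ v → trans (proj₁ p (fV g v)) (cong (fV f′) (proj₁ q v)))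
    , (λ e → trans (proj₂ p (fE g e)) (cong (fE f′) (proj₂ q e)))
  }

-- A subset of V is a predicate V → Set; equality of subsets is mutual
-- inclusion (_⇔_ pointwise).  The image 𝒫f(A) of A under f is
-- {x | ∃ y ∈ A, f y ≡ x}.

record Hypergraph : Set₁ where
  field
    V E : Set
    ε : E → V → Set

Pair : {V : Set} → V → V → V → Set
Pair v w x = (x ≡ v) ⊎ (x ≡ w)

-- 1 ≤ |ε(e)| ≤ 2  ⟺  ε(e) = {v, w} for some v, w (possibly equal)
IsMultigraph : Hypergraph → Set
IsMultigraph G = ∀ e → Σ (Hypergraph.V G) λ v → Σ (Hypergraph.V G) λ w →
                   ∀ x → Hypergraph.ε G e x ⇔ Pair v w x

record Multigraph : Set₁ where
  field
    graph : Hypergraph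
    isMultigraph : IsMultigraph graph
  open Hypergraph graph public

record HypergraphHom (G H : Hypergraph) : Set₁ where
  private
    module G = Hypergraph G
    module H = Hypergraph H
  field
    hE : G.E → H.E
    hV : G.V → H.V
    -- ε_H ∘ E(φ) = 𝒫V(φ) ∘ ε_G
    ε-comm : ∀ e x → H.ε (hE e) x ⇔ (Σ G.V λ y → G.ε e y × hV y ≡ x)
open HypergraphHom

_≈H_ : ∀ {G H} → HypergraphHom G H → HypergraphHom G H → Set
f ≈H g = (∀ v → hV f v ≡ hV g v) × (∀ e → hE f e ≡ hE g e)

idH : ∀ {G} → HypergraphHom G G
idH {G} = record
  { hE = λ e → e
  ; hV = λ v → v
  ; ε-comm = λ e x → mk⇔ (λ p → x , p , refl) (λ { (y , p , refl) → p })
  }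

_∘H_ : ∀ {F G H} → HypergraphHom G H → HypergraphHom F G → HypergraphHom F H
_∘H_ {F} {G} {H} g f = record
  { hE = λ e → hE g (hE f e)
  ; hV = λ v → hV g (hV f v)
  ; ε-comm = λ e x → mk⇔
      (λ p → let (y , q , r) = Equivalence.to (ε-comm g (hE f e) x) p
                 (z , s , t) = Equivalence.to (ε-comm f e y) q
             in z , s , trans (cong (hV g) t) r)
      (λ { (z , s , t) → Equivalence.from (ε-comm g (hE f e) x)
             (hV f z , Equivalence.from (ε-comm f e (hV f z)) (z , s , refl) , t) })
  }

MultigraphCat : Category (lsuc 0ℓ) (lsuc 0ℓ) 0ℓ
MultigraphCat = record
  { Obj = Multigraph
  ; _⇒_ = λ G H → HypergraphHom (Multigraph.graph G) (Multigraph.graph H)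
  ; _≈_ = _≈H_
  ; id = idH
  ; _∘_ = _∘H_
  ; ≈-equiv = record
      { refl = (λ _ → refl) , (λ _ → refl)
      ; sym = λ p → (λ v → sym (proj₁ p v)) , (λ e → sym (proj₂ p e))
      ; trans = λ p q → (λ v → trans (proj₁ p v) (proj₁ q v))
                      , (λ e → trans (proj₂ p e) (proj₂ q e))
      }
  ; assoc = λ _ _ _ → (λ _ → refl) , (λ _ → refl)
  ; identityˡ = λ _ → (λ _ → refl) , (λ _ → refl)
  ; identityʳ = λ _ → (λ _ → refl) , (λ _ → refl)
  ; ∘-resp-≈ = λ {_} {_} {_} {f} {f′} {g} {g′} p q →
      (λ v → trans (proj₁ p (hV g v)) (cong (hV f′) (proj₁ q v)))
    , (λ e → trans (proj₂ p (hE g e)) (cong (hE f′) (proj₂ q e)))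
  }

U₀ : Quiver → Multigraph
U₀ Q = record
  { graph = record { V = Q.V ; E = Q.E ; ε = λ e → Pair (Q.σ e) (Q.τ e) }
  ; isMultigraph = λ e → Q.σ e , Q.τ e , λ x → mk⇔ (λ p → p) (λ p → p)
  }
  where module Q = Quiver Q

U₁ : ∀ {Q R} → QuiverHom Q R →
     HypergraphHom (Multigraph.graph (U₀ Q)) (Multigraph.graph (U₀ R))
U₁ {Q} {R} f = record
  { hE = fE f
  ; hV = fV f
  ; ε-comm = λ e x → mk⇔
      (λ { (inj₁ p) → Q.σ e , inj₁ refl , sym (trans p (σ-comm f e))
         ; (inj₂ p) → Q.τ e , inj₂ refl , sym (trans p (τ-comm f e)) })
      (λ { (y , inj₁ refl , refl) → inj₁ (sym (σ-comm f e))
         ; (y , inj₂ refl , refl) → inj₂ (sym (τ-comm f e)) })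
  }
  where
    module Q = Quiver Q

U : Functor QuiverCat MultigraphCat
U = record
  { F₀ = U₀
  ; F₁ = U₁
  ; identity = (λ _ → refl) , (λ _ → refl)
  ; homomorphism = λ _ _ → (λ _ → refl) , (λ _ → refl)
  ; F-resp-≈ = λ p → p
  }

-- The associated digraph functor D⃗
-- Edges of D⃗(G): triples (e, v, w) with ε_G(e) = {v, w}; this is exactly
-- {(e,v,w) : ε(e) = {v,w}, v ≠ w} ∪ {(e,v,v) : ε(e) = {v}}.  The proof of
-- ε(e) = {v,w} is an irrelevant field, so it does not affect edge identity.

record DEdge (G : Multigraph) : Set where
  constructor dedge
  field
    edge : Multigraph.E G
    src tgt : Multigraph.V G
    .isPair : ∀ x → Multigraph.ε G edge x ⇔ Pair src tgt x

D₀ : Multigraph → Quiver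
D₀ G = record
  { V = Multigraph.V G
  ; E = DEdge G
  ; σ = DEdge.src
  ; τ = DEdge.tgt
  }

private
  imagePair : ∀ {G H : Multigraph}
              (φ : HypergraphHom (Multigraph.graph G) (Multigraph.graph H))
              e v w → (∀ x → Multigraph.ε G e x ⇔ Pair v w x) →
              ∀ x → Multigraph.ε H (hE φ e) x ⇔ Pair (hV φ v) (hV φ w) x
  imagePair φ e v w p x = mk⇔
    (λ q → let (y , r , s) = Equivalence.to (ε-comm φ e x) q in
           [ (λ { refl → inj₁ (sym s) }) , (λ { refl → inj₂ (sym s) }) ]
             (Equivalence.to (p y) r))
    (λ { (inj₁ refl) → Equivalence.from (ε-comm φ e _) (v , Equivalence.from (p v) (inj₁ refl) , refl)
       ; (inj₂ refl) → Equivalence.from (ε-comm φ e _) (w , Equivalence.from (p w) (inj₂ refl) , refl) })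
    where open import Data.Sum using ([_,_])

D₁ : ∀ {G H : Multigraph} →
     HypergraphHom (Multigraph.graph G) (Multigraph.graph H) →
     QuiverHom (D₀ G) (D₀ H)
D₁ {G} {H} φ = record
  { fV = hV φ
  ; fE = λ { (dedge e v w p) →
               dedge {H} (hE φ e) (hV φ v) (hV φ w) (imagePair {G} {H} φ e v w p) }
  ; σ-comm = λ _ → refl
  ; τ-comm = λ _ → refl
  }

private
  dedge-cong : ∀ {G : Multigraph} {e e′ v v′ w w′}
               .{p : ∀ x → Multigraph.ε G e x ⇔ Pair v w x}
               .{p′ : ∀ x → Multigraph.ε G e′ x ⇔ Pair v′ w′ x} →
               e ≡ e′ → v ≡ v′ → w ≡ w′ → dedge {G} e v w p ≡ dedge {G} e′ v′ w′ p′
  dedge-cong refl refl refl = refl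

D⃗ : Functor MultigraphCat QuiverCat
D⃗ = record
  { F₀ = D₀
  ; F₁ = λ {A} {B} → D₁ {A} {B}
  ; identity = (λ _ → refl) , (λ _ → refl)
  ; homomorphism = λ _ _ → (λ _ → refl) , (λ _ → refl)
  ; F-resp-≈ = λ {A} {B} {f} {g} p → proj₁ p , (λ { (dedge e v w q) →
                   dedge-cong {G = B} (proj₂ p e) (proj₁ p v) (proj₁ p w) })
  }

module Submission where

-- Both functors fail to preserve a very small (co)limit.
--
-- Products of quivers are computed componentwise,
-- so the square A × A of the single arrow A = (0 → 1) has exactly one edge,
-- running from (0,0) to (1,1).  The single-edge multigraph I = U(A) carries a
-- cone over the pair (U A, U A) whose legs are the identity and the swap of
-- the endpoints.  A mediating map I → U(A × A) would send vertex 0 to (0,1);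
-- but multigraph morphisms send endpoints of an edge to endpoints of its
-- image, and (0,1) lies on no edge of U(A × A).
--
-- Gluing the endpoints of I (the coequalizer of the two
-- vertex inclusions • ⇉ I) gives the one-loop multigraph L.  D⃗(I) has the
-- two opposite arrows 0 → 1 and 1 → 0, both sent by D⃗ to the unique edge of
-- D⃗(L); a cocone on D⃗ of the diagram sending them to distinct loops of a
-- quiver therefore cannot factor through D⃗(L).

open import Defs
open import Data.Product using (_×_)
open import Relation.Nullary using (¬_)

open import Level using (Level)
open import Data.Product using (Σ; _,_; proj₁; proj₂)
open import Data.Sum using (inj₁; inj₂; swap)
open import Data.Bool using (Bool; true; false; not)
open import Data.Bool.Properties using (not-involutive)
open import Data.Unit using (⊤; tt)
open import Data.Empty using (⊥; ⊥-elim)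
open import Function.Bundles using (mk⇔; Equivalence)
import Function.Properties.Equivalence as ⇔
open import Relation.Binary.PropositionalEquality
  using (_≡_; _≢_; refl; sym; trans; cong; cong₂; module ≡-Reasoning)
open import Relation.Binary.Structures using (IsEquivalence)

open QuiverHom
open HypergraphHom

false≢true : false ≢ true
false≢true ()

private
  variable
    o h e : Level

Discrete : Set → SmallCategory
Discrete A = record
  { Obj = A
  ; _⇒_ = _≡_
  ; _≈_ = λ _ _ → ⊤
  ; id = refl
  ; _∘_ = λ g f → trans f g
  ; ≈-equiv = record { refl = tt ; sym = λ _ → tt ; trans = λ _ _ → tt }
  ; assoc = λ _ _ _ → tt
  ; identityˡ = λ _ → tt
  ; identityʳ = λ _ → tt
  ; ∘-resp-≈ = λ _ _ → tt
  }

-- The walking parallel pair: a source object (false), a target object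
-- (true), and two non-identity arrows from source to target, named by Bool.
PPHom : Bool → Bool → Set
PPHom false false = ⊤
PPHom true  true  = ⊤
PPHom false true  = Bool
PPHom true  false = ⊥

ppId : ∀ {X} → PPHom X X
ppId {false} = tt
ppId {true}  = tt

ppComp : ∀ {X Y Z} → PPHom Y Z → PPHom X Y → PPHom X Z
ppComp {false} {false} g _ = g
ppComp {false} {true}  {true} _ f = f
ppComp {true}  {true}  {true} _ _ = tt
ppComp {true}  {false} _ ()
ppComp {_}     {true}  {false} () _

ppAssoc : ∀ {W X Y Z} (f : PPHom W X) (g : PPHom X Y) (k : PPHom Y Z) →
          ppComp (ppComp k g) f ≡ ppComp k (ppComp g f)
ppAssoc {false} {false} {false} _ _ _ = refl
ppAssoc {false} {false} {true} {true} _ _ _ = refl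
ppAssoc {false} {true}  {true} {true} _ _ _ = refl
ppAssoc {true}  {true}  {true} {true} _ _ _ = refl
ppAssoc {true}  {false} () _ _
ppAssoc {_} {true} {false} _ () _
ppAssoc {_} {_} {true} {false} _ _ ()

ppIdˡ : ∀ {X Y} (f : PPHom X Y) → ppComp ppId f ≡ f
ppIdˡ {false} {false} _ = refl
ppIdˡ {false} {true}  _ = refl
ppIdˡ {true}  {true}  _ = refl
ppIdˡ {true}  {false} ()

ppIdʳ : ∀ {X Y} (f : PPHom X Y) → ppComp f ppId ≡ f
ppIdʳ {false} {false} _ = refl
ppIdʳ {false} {true}  _ = refl
ppIdʳ {true}  {true}  _ = refl
ppIdʳ {true}  {false} ()

ParallelPair : SmallCategory
ParallelPair = record
  { Obj = Bool
  ; _⇒_ = PPHom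
  ; _≈_ = _≡_
  ; id = ppId
  ; _∘_ = ppComp
  ; ≈-equiv = record { refl = refl ; sym = sym ; trans = trans }
  ; assoc = ppAssoc
  ; identityˡ = ppIdˡ
  ; identityʳ = ppIdʳ
  ; ∘-resp-≈ = λ { refl refl → refl }
  }

module _ (C : Category o h e) where
  open Category C
  private
    module Eq {A B} = IsEquivalence (≈-equiv {A} {B})

  discreteDiagram : {A : Set} → (A → Obj) → Functor (Discrete A) C
  discreteDiagram X = record
    { F₀ = X
    ; F₁ = λ { refl → id }
    ; identity = Eq.refl
    ; homomorphism = λ { refl refl → Eq.sym (identityˡ id) }
    ; F-resp-≈ = λ { {f = refl} {g = refl} _ → Eq.refl }
    }

  discreteCone : {A : Set} (F : Functor (Discrete A) C) (apex : Obj) →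
                 (∀ a → apex ⇒ Functor.F₀ F a) → Cone F
  discreteCone F apex legs = record
    { apex = apex
    ; leg = legs
    ; commute = λ { refl → Eq.trans (∘-resp-≈ F.identity Eq.refl) (identityˡ _) }
    }
    where module F = Functor F

  parallelPair : ∀ {A B} → (Bool → A ⇒ B) → Functor ParallelPair C
  parallelPair {A} {B} f = record
    { F₀ = obj
    ; F₁ = mor
    ; identity = λ {X} → identity {X}
    ; homomorphism = homomorphism
    ; F-resp-≈ = λ { refl → Eq.refl }
    }
    where
      obj : Bool → Obj
      obj false = A
      obj true  = B

      mor : ∀ {X Y} → PPHom X Y → obj X ⇒ obj Y
      mor {false} {false} _ = id
      mor {true}  {true}  _ = id
      mor {false} {true}  b = f b

      identity : ∀ {X} → mor (ppId {X}) ≈ id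
      identity {false} = Eq.refl
      identity {true}  = Eq.refl

      homomorphism : ∀ {X Y Z} (g : PPHom X Y) (k : PPHom Y Z) →
                     mor (ppComp k g) ≈ mor k ∘ mor g
      homomorphism {false} {false} {false} _ _ = Eq.sym (identityˡ id)
      homomorphism {false} {false} {true}  _ _ = Eq.sym (identityʳ _)
      homomorphism {false} {true}  {true}  _ _ = Eq.sym (identityˡ _)
      homomorphism {true}  {true}  {true}  _ _ = Eq.sym (identityˡ id)
      homomorphism {true}  {false} () _
      homomorphism {_}     {true}  {false} _ ()

  module _ (F : Functor ParallelPair C) where
    private module F = Functor F

    coequalizingCocone : ∀ {Z} (k : F.F₀ true ⇒ Z) →
                         k ∘ F.F₁ {false} {true} false ≈ k ∘ F.F₁ {false} {true} true →
                         Cocone F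
    coequalizingCocone {Z} k equalizes = record
      { coapex = Z
      ; coleg = coleg
      ; cocommute = cocommute
      }
      where
        coleg : ∀ X → F.F₀ X ⇒ Z
        coleg false = k ∘ F.F₁ {false} {true} false
        coleg true  = k

        idLeg : ∀ X → coleg X ∘ F.F₁ (ppId {X}) ≈ coleg X
        idLeg X = Eq.trans (∘-resp-≈ Eq.refl F.identity) (identityʳ _)

        cocommute : ∀ {X Y} (g : PPHom X Y) → coleg Y ∘ F.F₁ g ≈ coleg X
        cocommute {false} {false} tt = idLeg false
        cocommute {true}  {true}  tt = idLeg true
        cocommute {false} {true}  false = Eq.refl
        cocommute {false} {true}  true  = Eq.sym equalizes
        cocommute {true}  {false} ()

    coleg-equalizes : (c : Cocone F) →
                      Cocone.coleg c true ∘ F.F₁ {false} {true} false ≈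
                      Cocone.coleg c true ∘ F.F₁ {false} {true} true
    coleg-equalizes c = Eq.trans (cocommute false) (Eq.sym (cocommute true))
      where open Cocone c

endpointsPreserved : ∀ {G H} (φ : HypergraphHom G H) {e v} →
                     Hypergraph.ε G e v → Hypergraph.ε H (hE φ e) (hV φ v)
endpointsPreserved φ {e} {v} p = Equivalence.from (ε-comm φ e _) (v , p , refl)

_×Q_ : Quiver → Quiver → Quiver
Q₁ ×Q Q₂ = record
  { V = Q₁.V × Q₂.V
  ; E = Q₁.E × Q₂.E
  ; σ = λ { (e₁ , e₂) → Q₁.σ e₁ , Q₂.σ e₂ }
  ; τ = λ { (e₁ , e₂) → Q₁.τ e₁ , Q₂.τ e₂ }
  }
  where
    module Q₁ = Quiver Q₁
    module Q₂ = Quiver Q₂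

module _ (Q₁ Q₂ : Quiver) where
  pick : Bool → Quiver
  pick true  = Q₁
  pick false = Q₂

  pairDiagram : Functor (Discrete Bool) QuiverCat
  pairDiagram = discreteDiagram QuiverCat pick

  projection : ∀ b → QuiverHom (Q₁ ×Q Q₂) (pick b)
  projection true  = record { fV = proj₁ ; fE = proj₁ ; σ-comm = λ _ → refl ; τ-comm = λ _ → refl }
  projection false = record { fV = proj₂ ; fE = proj₂ ; σ-comm = λ _ → refl ; τ-comm = λ _ → refl }

  productCone : Cone pairDiagram
  productCone = discreteCone QuiverCat pairDiagram (Q₁ ×Q Q₂) projection

  productIsLimit : IsLimit pairDiagram productCone
  productIsLimit c = pairing , factors , unique
    where
      open Cone c
      pairing : QuiverHom apex (Q₁ ×Q Q₂)
      pairing = record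
        { fV = λ v → fV (leg true) v , fV (leg false) v
        ; fE = λ e → fE (leg true) e , fE (leg false) e
        ; σ-comm = λ e → cong₂ _,_ (σ-comm (leg true) e) (σ-comm (leg false) e)
        ; τ-comm = λ e → cong₂ _,_ (τ-comm (leg true) e) (τ-comm (leg false) e)
        }
      factors : ∀ b → (projection b ∘Q pairing) ≈Q leg b
      factors true  = (λ _ → refl) , (λ _ → refl)
      factors false = (λ _ → refl) , (λ _ → refl)
      unique : ∀ u → (∀ b → (projection b ∘Q u) ≈Q leg b) → u ≈Q pairing
      unique u p = (λ v → cong₂ _,_ (proj₁ (p true) v) (proj₁ (p false) v))
                 , (λ e → cong₂ _,_ (proj₂ (p true) e) (proj₂ (p false) e))

-- The single arrow 0 → 1 (0 = false, 1 = true).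
Arrow : Quiver
Arrow = record { V = Bool ; E = ⊤ ; σ = λ _ → false ; τ = λ _ → true }

Edge : Multigraph
Edge = U₀ Arrow

edgeEndpoint : ∀ x → Hypergraph.ε (Multigraph.graph Edge) tt x
edgeEndpoint false = inj₁ refl
edgeEndpoint true  = inj₂ refl

-- Swapping the endpoints is an automorphism of I, though not of Arrow.
swapEdge : HypergraphHom (Multigraph.graph Edge) (Multigraph.graph Edge)
swapEdge = record
  { hE = λ e → e
  ; hV = not
  ; ε-comm = λ _ x → mk⇔ (λ _ → not x , edgeEndpoint (not x) , not-involutive x)
                          (λ _ → edgeEndpoint x)
  }

diagonalEndpoints : ∀ {e v} → Hypergraph.ε (Multigraph.graph (U₀ (Arrow ×Q Arrow))) e v →
                    proj₁ v ≡ proj₂ v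
diagonalEndpoints (inj₁ refl) = refl
diagonalEndpoints (inj₂ refl) = refl

identityAndSwap : ∀ b → HypergraphHom (Multigraph.graph Edge)
                                      (Multigraph.graph (U₀ (pick Arrow Arrow b)))
identityAndSwap true  = idH
identityAndSwap false = swapEdge

-- A mediating map u : I → U(A × A) would send vertex 0 to (0,1), an endpoint
-- of the image edge that is not diagonal.
U-notContinuous : ¬ Continuous U
U-notContinuous continuous
  with continuous (pairDiagram Arrow Arrow) (productCone Arrow Arrow)
                  (productIsLimit Arrow Arrow)
                  (discreteCone MultigraphCat (U ∘F pairDiagram Arrow Arrow)
                                Edge identityAndSwap)
... | u , factors , _ = false≢true (begin
  false              ≡⟨ sym (proj₁ (factors true) false) ⟩
  proj₁ (hV u false) ≡⟨ diagonalEndpoints (endpointsPreserved u (inj₁ refl)) ⟩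
  proj₂ (hV u false) ≡⟨ proj₁ (factors false) false ⟩
  true               ∎)
  where open ≡-Reasoning

Point : Multigraph
Point = record
  { graph = record { V = ⊤ ; E = ⊥ ; ε = λ () }
  ; isMultigraph = λ ()
  }

endpointAt : Bool → HypergraphHom (Multigraph.graph Point) (Multigraph.graph Edge)
endpointAt b = record { hE = λ () ; hV = λ _ → b ; ε-comm = λ () }

endpointPair : Functor ParallelPair MultigraphCat
endpointPair = parallelPair MultigraphCat {Point} {Edge} endpointAt

Loop : Multigraph
Loop = record
  { graph = record { V = ⊤ ; E = ⊤ ; ε = λ _ _ → ⊤ }
  ; isMultigraph = λ _ → tt , tt , λ _ → mk⇔ (λ _ → inj₁ refl) (λ _ → tt)
  }

glue : HypergraphHom (Multigraph.graph Edge) (Multigraph.graph Loop)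
glue = record
  { hE = λ _ → tt
  ; hV = λ _ → tt
  ; ε-comm = λ _ _ → mk⇔ (λ _ → false , inj₁ refl , refl) (λ _ → tt)
  }

gluingCocone : Cocone endpointPair
gluingCocone = coequalizingCocone MultigraphCat endpointPair {Loop} glue ((λ _ → refl) , (λ ()))

factorThroughLoop : ∀ {Z} (k : HypergraphHom (Multigraph.graph Edge) Z) →
                    hV k false ≡ hV k true → HypergraphHom (Multigraph.graph Loop) Z
factorThroughLoop {Z} k glued = record
  { hE = λ _ → hE k tt
  ; hV = λ _ → hV k false
  ; ε-comm = λ _ x → mk⇔ (incident x)
      (λ { (_ , _ , r) → Equivalence.from (ε-comm k tt x) (false , inj₁ refl , r) })
  }
  where
    incident : ∀ x → Hypergraph.ε Z (hE k tt) x → Σ ⊤ λ _ → ⊤ × hV k false ≡ x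
    incident x p with Equivalence.to (ε-comm k tt x) p
    ... | false , _ , r = tt , tt , r
    ... | true  , _ , r = tt , tt , trans glued r

gluingIsColimit : IsColimit endpointPair gluingCocone
gluingIsColimit c = u , factors , unique
  where
    open Cocone c
    k : HypergraphHom (Multigraph.graph Edge) (Multigraph.graph coapex)
    k = coleg true
    glued : hV k false ≡ hV k true
    glued = proj₁ (coleg-equalizes MultigraphCat endpointPair c) tt
    u : HypergraphHom (Multigraph.graph Loop) (Multigraph.graph coapex)
    u = factorThroughLoop k glued
    factors : ∀ X → (u ∘H Cocone.coleg gluingCocone X) ≈H coleg X
    factors false = (λ _ → proj₁ (cocommute {false} {true} false) tt) , (λ ())
    factors true  = (λ { false → refl ; true → glued }) , (λ _ → refl)
    unique : ∀ u′ → (∀ X → (u′ ∘H Cocone.coleg gluingCocone X) ≈H coleg X) → u′ ≈H u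
    unique u′ p = (λ _ → proj₁ (p true) false) , (λ _ → proj₂ (p true) tt)

forwardArrow backwardArrow : DEdge Edge
forwardArrow  = dedge tt false true (λ _ → ⇔.refl)
backwardArrow = dedge tt true false (λ _ → mk⇔ swap swap)

-- D⃗ of the gluing map merges them: D⃗(L) has only one edge.
glue-merges-arrows : fE (D₁ {Edge} {Loop} glue) forwardArrow ≡
                     fE (D₁ {Edge} {Loop} glue) backwardArrow
glue-merges-arrows = refl

TwoLoops : Quiver
TwoLoops = record { V = ⊤ ; E = Bool ; σ = λ _ → tt ; τ = λ _ → tt }

bySource : QuiverHom (D₀ Edge) TwoLoops
bySource = record { fV = λ _ → tt ; fE = DEdge.src ; σ-comm = λ _ → refl ; τ-comm = λ _ → refl }

bySourceCocone : Cocone (D⃗ ∘F endpointPair)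
bySourceCocone = coequalizingCocone QuiverCat (D⃗ ∘F endpointPair) bySource
                   ((λ _ → refl) , (λ d → ⊥-elim (DEdge.edge d)))

-- A mediating map u : D⃗(L) → TwoLoops would have to send the single edge of
-- D⃗(L) to both loops.
D⃗-notCocontinuous : ¬ Cocontinuous D⃗
D⃗-notCocontinuous cocontinuous
  with cocontinuous endpointPair gluingCocone gluingIsColimit bySourceCocone
... | u , factors , _ = false≢true (begin
  false                             ≡⟨ sym (proj₂ (factors true) forwardArrow) ⟩
  fE u (fE (D₁ glue) forwardArrow)  ≡⟨ cong (fE u) glue-merges-arrows ⟩
  fE u (fE (D₁ glue) backwardArrow) ≡⟨ proj₂ (factors true) backwardArrow ⟩
  true                              ∎)
  where open ≡-Reasoning

mainTheorem11 : ¬ Continuous U × ¬ Cocontinuous D⃗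
mainTheorem11 = U-notContinuous , D⃗-notCocontinuous
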